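{- Let $q=\langle H,f,f^-,c,c^-\rangle$ be a consistent $q$-dialectical system with connectives and let $\alpha$ be a computable approximation to $H$ such that $(q,\alpha)$ is loopless. Then $A_q^\alpha$ is a completion.
   Context: An enumeration operator is a c.e. set $H$ of (codes of) pairs $\langle x,D\rangle$, $x\in\omega$, $D\subseteq\omega$ finite; $H(X)=\{x:\exists D\subseteq X\ \langle x,D\rangle\in H\}$. $H$ is an algebraic closure operator if $X\subseteq H(X)$ and $H(H(X))\subseteq H(X)$ for all $X$. A computable approximation $\alpha=\{H_s\}$ to $H$ is a computable increasing sequence of finite sets of pairs with union $H$. A $q$-dialectical system is $q=\langle H,f,f^-,c,c^-\rangle$ with $H$ an enumeration operator that is an algebraic closure operator, $H(\emptyset)\ne\emptyset$, $H(\{c\})=\omega$; $f$ a computable permutation of $\omega$ ($f_i=f(i)$); $f^-$ computable and acyclic (every $f^-$-orbit infinite); $c\in\omega$; $c^-\in\omega\setminus\mathrm{range}(f^-)$. It is consistent if $\{c,c^-\}\cap H(\emptyset)=\emptyset$. $q$-dialectical procedure relative to $\alpha$: stacks $r_s(x)$, $m(s)$, finite sets $A_s$; $\rho_s(x)$ = top of $r_s(x)$ when nonempty, $L_s(x)=\{\rho_s(y):y<x,\ r_s(y)\ne\langle\,\rangle\}$, $\chi_s(i)=H_s(L_s(i+1))$. Stage 0: $m(0)=0$, $r_0(0)=\langle f_0\rangle$, others empty, $A_0=\emptyset$. Stage $s+1$, $m=m(s)$: (1) if no $k\le m$ has $\{c,c^-\}\cap\chi_s(k)\ne\emptyset$: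 $m(s+1)=m+1$, stacks at $x\le m$ unchanged, $r_{s+1}(m+1)=\langle f_{m+1}\rangle$, above empty; (2) if some $k\le m$ has $c\in\chi_s(k)$ and $c^-\notin\chi_s(k')$ for all $k'<k$, let $z$ be least such: if $c\in H_s(\emptyset)$ then $m(s+1)=0$, $r_{s+1}(0)=\langle f_0\rangle$, others empty; otherwise $m(s+1)=z+1$, stacks at $x<z$ unchanged, $r_{s+1}(z+1)=\langle f_{z+1}\rangle$, $r_{s+1}(x)=\langle\,\rangle$ for $x=z$ and $x>z+1$; (3) if some $k\le m$ has $c^-\in\chi_s(k)$ and $c\notin\chi_s(k')$ for all $k'\le k$, let $z$ be least such: $m(s+1)=z$, stacks at $x<z$ unchanged, $r_{s+1}(z)=r_s(z)^\frown\langle f^-(\rho_s(z))\rangle$, stacks at $x>z$ empty. $A_{s+1}=\bigcup_{i<m(s+1)}\chi_{s+1}(i)$. $A_q^\alpha=\{f_x:\exists t\,\forall s\ge t\ f_x\in A_s\}$. $(q,\alpha)$ is loopless if for every $u$ the set $\{\rho_s(u):s\in\omega\}$ is finite. The system has connectives if there are injective computable functions $\neg,\to,\wedge,\vee$ on $\omega$ such that for all $X\subseteq\omega$, $x,y\in\omega$: (1) $c\in H(\{x,\neg x\})$; (2) $H(\{\neg\neg x\})=H(\{x\})$; (3) $x\vee\neg x\in H(\emptyset)$; (4) $H(X\cup\{x\vee y\})=H(X\cup\{x\})\cap H(X\cup\{y\})$; (5) if $c\in H(X\cup\{x\})$ then $\neg x\in H(X)$; (6) $x\in H(X\cup\{y\})$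 iff $y\to x\in H(X)$. A set $A$ is a completion if for every $x$, $A\cap\{x,\neg x\}$ has exactly one element. -}

module Defs where

open import Level using (0ℓ)
open import Data.Nat.Base using (ℕ; zero; suc; _≤_; _<_; _<ᵇ_; _≡ᵇ_)
open import Data.Nat.Properties using (_≟_)
open import Data.Bool.Base using (Bool; true; false; if_then_else_; _∧_; _∨_; not)
open import Data.Maybe.Base using (Maybe; just; nothing)
open import Data.List.Base using (List; []; _∷_; _++_; head)
open import Data.List.Relation.Unary.Any using (Any; any?)
open import Data.List.Relation.Unary.All using (All; all?)
open import Data.List.Membership.Propositional using (_∈_)
open import Data.List.Membership.DecPropositional _≟_ using (_∈?_)
open import Data.Product.Base using (_×_; _,_; proj₁; proj₂; ∃; Σ)
open import Data.Sum.Base using (_⊎_)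
open import Relation.Nullary using (¬_; Dec; does)
open import Relation.Nullary.Decidable.Core using (_×-dec_)
open import Relation.Unary using (Pred; _⊆_; _∪_; _∩_; ｛_｝; ∅; _≐_; U)
open import Relation.Binary.PropositionalEquality using (_≡_; _≢_)
open import Function.Definitions using (Bijective)

-- Enumeration operators given through a computable approximation.
-- A stage H_s is a finite list of pairs ⟨x , D⟩ (D a finite set, coded
-- as a list).  Agda functions are the computable functions.

Approx : Set
Approx = ℕ → List (ℕ × List ℕ)

IsIncreasing : Approx → Set
IsIncreasing α = ∀ s {p} → p ∈ α s → p ∈ α (suc s)

HsOp : Approx → ℕ → Pred ℕ 0ℓ → Pred ℕ 0ℓ
HsOp α s X y = Any (λ p → proj₁ p ≡ y × All X (proj₂ p)) (α s)

-- H = ⋃_s H_s  (so α is by construction an approximation to H), and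
-- H(X) = { x : ∃ D ⊆ X, ⟨x,D⟩ ∈ H }
HOp : Approx → Pred ℕ 0ℓ → Pred ℕ 0ℓ
HOp α X y = ∃ λ s → HsOp α s X y

HsMem? : (α : Approx) (s : ℕ) (L : List ℕ) (y : ℕ) → Dec (HsOp α s (_∈ L) y)
HsMem? α s L y = any? (λ p → (proj₁ p ≟ y) ×-dec all? (λ z → z ∈? L) (proj₂ p)) (α s)

record QDS : Set where
  field
    f   : ℕ → ℕ
    f⁻  : ℕ → ℕ
    c   : ℕ
    c⁻  : ℕ

iter : (ℕ → ℕ) → ℕ → ℕ → ℕ
iter g zero    x = x
iter g (suc n) x = g (iter g n x)

record IsQDialectical (α : Approx) (q : QDS) : Set₁ where
  open QDS q
  field
    extensive   : ∀ (X : Pred ℕ 0ℓ) → X ⊆ HOp α X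
    idempotent  : ∀ (X : Pred ℕ 0ℓ) → HOp α (HOp α X) ⊆ HOp α X
    H∅-nonempty : ∃ λ y → HOp α ∅ y
    Hc-full     : ∀ y → HOp α ｛ c ｝ y
    f-perm      : Bijective _≡_ _≡_ f
    f⁻-acyclic  : ∀ x i j → iter f⁻ i x ≡ iter f⁻ j x → i ≡ j
    c⁻∉range    : ∀ x → f⁻ x ≢ c⁻

Consistent : Approx → QDS → Set
Consistent α q = ¬ HOp α ∅ (QDS.c q) × ¬ HOp α ∅ (QDS.c⁻ q)

record Connectives (α : Approx) (q : QDS) : Set₁ where
  open QDS q
  field
    neg : ℕ → ℕ
    imp : ℕ → ℕ → ℕ
    and : ℕ → ℕ → ℕ
    or  : ℕ → ℕ → ℕ
    neg-inj : ∀ {x y} → neg x ≡ neg y → x ≡ y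
    imp-inj : ∀ {x y x' y'} → imp x y ≡ imp x' y' → x ≡ x' × y ≡ y'
    and-inj : ∀ {x y x' y'} → and x y ≡ and x' y' → x ≡ x' × y ≡ y'
    or-inj  : ∀ {x y x' y'} → or x y ≡ or x' y' → x ≡ x' × y ≡ y'
    ax1 : ∀ x → HOp α (｛ x ｝ ∪ ｛ neg x ｝) c
    ax2 : ∀ x → HOp α ｛ neg (neg x) ｝ ≐ HOp α ｛ x ｝
    ax3 : ∀ x → HOp α ∅ (or x (neg x))
    ax4 : ∀ (X : Pred ℕ 0ℓ) x y →
          HOp α (X ∪ ｛ or x y ｝) ≐ (HOp α (X ∪ ｛ x ｝) ∩ HOp α (X ∪ ｛ y ｝))
    ax5 : ∀ (X : Pred ℕ 0ℓ) x → HOp α (X ∪ ｛ x ｝) c → HOp α X (neg x)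
    ax6 : ∀ (X : Pred ℕ 0ℓ) x y →
          (HOp α (X ∪ ｛ y ｝) x → HOp α X (imp y x)) ×
          (HOp α X (imp y x) → HOp α (X ∪ ｛ y ｝) x)

IsCompletion : (ℕ → ℕ) → Pred ℕ 0ℓ → Set
IsCompletion neg A = ∀ x → ∃ λ y →
  (A y × (y ≡ x ⊎ y ≡ neg x)) ×
  (∀ z → A z × (z ≡ x ⊎ z ≡ neg x) → z ≡ y)

least : (ℕ → Bool) → ℕ → Maybe ℕ
least P zero = if P zero then just zero else nothing
least P (suc m) with least P m
... | just k  = just k
... | nothing = if P (suc m) then just (suc m) else nothing

allLt : (ℕ → Bool) → ℕ → Bool
allLt P zero    = true
allLt P (suc k) = allLt P k ∧ P k

-- a stack is a list whose head is the top
Stacks : Set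
Stacks = ℕ → List ℕ

record State : Set where
  constructor ⟨_,_⟩
  field
    m : ℕ
    r : Stacks

topL : List ℕ → List ℕ
topL []      = []
topL (a ∷ _) = a ∷ []

Lset : Stacks → ℕ → List ℕ
Lset r zero    = []
Lset r (suc x) = Lset r x ++ topL (r x)

-- push f⁻(ρ(z)) on top of the stack at z (stack nonempty whenever used)
push : (ℕ → ℕ) → List ℕ → List ℕ
push g []      = []
push g (a ∷ as) = g a ∷ a ∷ as

module Procedure (α : Approx) (q : QDS) where
  open QDS q

  initState : State
  initState = ⟨ 0 , (λ x → if x ≡ᵇ 0 then f 0 ∷ [] else []) ⟩

  χ? : ℕ → Stacks → ℕ → ℕ → Bool
  χ? s r k y = does (HsMem? α s (Lset r (suc k)) y)

  step : ℕ → State → State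
  step s ⟨ m , r ⟩ with least P1 m
    where
      P1 : ℕ → Bool
      P1 k = χ? s r k c ∨ χ? s r k c⁻
  ... | nothing =
    ⟨ suc m , (λ x → if x <ᵇ suc m then r x
                       else if x ≡ᵇ suc m then f (suc m) ∷ [] else []) ⟩
  ... | just _ with least P2 m | least P3 m
    where
      P2 : ℕ → Bool
      P2 k = χ? s r k c ∧ allLt (λ k' → not (χ? s r k' c⁻)) k
      P3 : ℕ → Bool
      P3 k = χ? s r k c⁻ ∧ allLt (λ k' → not (χ? s r k' c)) (suc k)
  ... | just z | _ =
    if does (HsMem? α s [] c) then initState
    else ⟨ suc z , (λ x → if x <ᵇ z then r x
                          else if x ≡ᵇ suc z then f (suc z) ∷ [] else []) ⟩
  ... | nothing | just z =
    ⟨ z , (λ x → if x <ᵇ z then r x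
                 else if x ≡ᵇ z then push f⁻ (r z) else []) ⟩
  ... | nothing | nothing = ⟨ m , r ⟩                    -- unreachable

  state : ℕ → State
  state zero    = initState
  state (suc s) = step s (state s)

  mstage : ℕ → ℕ
  mstage s = State.m (state s)

  rstage : ℕ → Stacks
  rstage s = State.r (state s)

  ρ : ℕ → ℕ → Maybe ℕ
  ρ s u = head (rstage s u)

  χ : ℕ → ℕ → Pred ℕ 0ℓ
  χ s i = HsOp α s (_∈ Lset (rstage s) (suc i))

  Aₛ : ℕ → Pred ℕ 0ℓ
  Aₛ s y = ∃ λ i → i < mstage s × χ s i y

  Aq : Pred ℕ 0ℓ
  Aq y = ∃ λ x → f x ≡ y × ∃ λ t → ∀ s → t ≤ s → Aₛ s (f x)

  Loopless : Set
  Loopless = ∀ u → ∃ λ (ls : List ℕ) → ∀ s y → ρ s u ≡ just y → y ∈ ls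

-- Every level u of the procedure eventually settles.  Once the levels below u
-- have settled, each step keeps the stack at u, empties it, or pushes f⁻ of its
-- top; a stack that never settles would therefore run through an infinite
-- f⁻-orbit using only finitely many tops, against looplessness (this is where
-- excluded middle enters).  In the limit, A_q^α is the set of consequences of
-- the settled tops, so it contains neither c nor c⁻, and every proposal f x has
-- either been kept, and is then in A_q^α, or been refuted, relative to the levels
-- below it, by deriving c or c⁻.  With the connectives, refuting y by c gives ¬y,
-- refuting ¬y by c gives y, and refuting both y and ¬y by c⁻ would derive c⁻ by
-- cases on y ∨ ¬y.

module Submission where

open import Defs
open import Level using (0ℓ)
open import Axiom.ExcludedMiddle using (ExcludedMiddle)
open import Data.Nat.Base
open import Data.Nat.Properties
open import Data.Bool.Base using (Bool; true; false; if_then_else_; _∧_; _∨_; not)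
open import Data.Maybe.Base using (just; nothing)
open import Data.List.Base using (List; []; _∷_; _++_; head; length; lookup)
open import Data.List.Properties using (++-identityʳ; ≡-dec)
open import Data.List.Relation.Unary.Any as Any using (here)
open import Data.List.Relation.Unary.Any.Properties using (lookup-index)
import Data.List.Relation.Unary.All as All
open import Data.List.Membership.Propositional using (_∈_)
open import Data.List.Relation.Binary.Subset.Propositional.Properties using (Any-resp-⊆)
open import Data.List.Membership.Propositional.Properties using (∈-++⁺ˡ; ∈-++⁺ʳ; ∈-++⁻)
open import Data.Fin.Base using (Fin; toℕ)
open import Data.Fin.Properties using (pigeonhole)
open import Data.Product.Base using (∃; _×_; _,_; proj₁; proj₂)
open import Data.Sum.Base as Sum using (_⊎_; inj₁; inj₂; [_,_]′)
open import Data.Empty using (⊥; ⊥-elim)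
open import Function.Base using (id; _∘_)
open import Function.Consequences using (surjective⇒strictlySurjective)
open import Relation.Nullary using (¬_; Dec; yes; no; contradiction)
open import Relation.Nullary.Reflects
  using (Reflects; ofʸ; ofⁿ; fromEquivalence; ¬-reflects; _×-reflects_; _⊎-reflects_)
open import Relation.Nullary.Decidable using (decidable-stable)
open import Relation.Unary using (Pred; _⊆_; _∪_; ｛_｝; ∅)
open import Relation.Binary.PropositionalEquality
open import Relation.Binary.Definitions using (tri<; tri≈; tri>)

completion : ∀ {neg : ℕ → ℕ} {A D : Pred ℕ 0ℓ} → A ⊆ D → D ⊆ A →
             (∀ y → D y ⊎ D (neg y)) → (∀ y → D y → D (neg y) → ⊥) →
             IsCompletion neg A
completion {neg} A⊆D D⊆A decided consistent x with decided x
... | inj₁ Dx  = x , (D⊆A Dx , inj₁ refl) , λ where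
  _ (_ , inj₁ z≡x)    → z≡x
  _ (A¬x , inj₂ refl) → ⊥-elim (consistent x Dx (A⊆D A¬x))
... | inj₂ D¬x = neg x , (D⊆A D¬x , inj₂ refl) , λ where
  _ (_ , inj₂ z≡¬x) → z≡¬x
  _ (Ax , inj₁ refl) → ⊥-elim (consistent x (A⊆D Ax) D¬x)

-- Bounded search

if-yes : ∀ {A : Set} {B : Set} {b} {x y : B} → Reflects A b → A → (if b then x else y) ≡ x
if-yes (ofʸ _)  _ = refl
if-yes (ofⁿ ¬a) a = contradiction a ¬a

if-no : ∀ {A : Set} {B : Set} {b} {x y : B} → Reflects A b → ¬ A → (if b then x else y) ≡ y
if-no (ofʸ a) ¬a = contradiction a ¬a
if-no (ofⁿ _) _  = refl

≡ᵇ-reflects-≡ : ∀ m n → Reflects (m ≡ n) (m ≡ᵇ n)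
≡ᵇ-reflects-≡ m n = fromEquivalence (≡ᵇ⇒≡ m n) (≡⇒≡ᵇ m n)

allLt-reflects : ∀ {A : ℕ → Set} {P : ℕ → Bool} → (∀ k → Reflects (A k) (P k)) →
                 ∀ k → Reflects (∀ k′ → k′ < k → A k′) (allLt P k)
allLt-reflects A? zero = ofʸ (λ _ ())
allLt-reflects {A} {P} A? (suc k) with allLt P k | allLt-reflects A? k | P k | A? k
... | false | ofⁿ ¬below | _     | _      =
  ofⁿ (λ below → ¬below (λ k′ k′<k → below k′ (m<n⇒m<1+n k′<k)))
... | true  | ofʸ _      | false | ofⁿ ¬a = ofⁿ (λ below → ¬a (below k (n<1+n k)))
... | true  | ofʸ below  | true  | ofʸ a  = ofʸ below′
  where
  below′ : ∀ k′ → k′ < suc k → A k′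
  below′ k′ k′<1+k with m<1+n⇒m<n∨m≡n k′<1+k
  ... | inj₁ k′<k = below k′ k′<k
  ... | inj₂ refl = a

module _ {A : ℕ → Set} {P : ℕ → Bool} (A? : ∀ k → Reflects (A k) (P k)) where

  least≡nothing⇒ : ∀ m → least P m ≡ nothing → ∀ k → k ≤ m → ¬ A k
  least≡nothing⇒ zero e zero z≤n with P zero | A? zero
  least≡nothing⇒ zero () zero z≤n | true  | _
  ... | false | ofⁿ ¬a = ¬a
  least≡nothing⇒ (suc m) e k k≤1+m with least P m in e′
  least≡nothing⇒ (suc m) () k k≤1+m | just _
  ... | nothing with P (suc m) | A? (suc m)
  least≡nothing⇒ (suc m) () k k≤1+m | nothing | true | _
  ... | false | ofⁿ ¬a with m≤n⇒m<n∨m≡n k≤1+m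
  ... | inj₁ k<1+m = least≡nothing⇒ m e′ k (s≤s⁻¹ k<1+m)
  ... | inj₂ refl  = ¬a

  least≡just⇒ : ∀ m {z} → least P m ≡ just z → z ≤ m × A z × (∀ k → k < z → ¬ A k)
  least≡just⇒ zero e with P zero | A? zero
  least≡just⇒ zero refl | true  | ofʸ a = z≤n , a , λ _ ()
  least≡just⇒ zero ()   | false | _
  least≡just⇒ (suc m) e with least P m in e′
  least≡just⇒ (suc m) refl | just z with least≡just⇒ m e′
  ... | z≤m , a , first = m≤n⇒m≤1+n z≤m , a , first
  least≡just⇒ (suc m) e | nothing with P (suc m) | A? (suc m)
  least≡just⇒ (suc m) refl | nothing | true  | ofʸ a =
    ≤-refl , a , λ k k<1+m → least≡nothing⇒ m e′ k (s≤s⁻¹ k<1+m)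
  least≡just⇒ (suc m) ()   | nothing | false | _

-- Stacks

push-≢ : ∀ g {l : List ℕ} → l ≢ [] → push g l ≢ l
push-≢ g {[]}    l≢[] _ = l≢[] refl
push-≢ g {_ ∷ _} _    e = 1+n≢n (cong length e)

pushes : (ℕ → ℕ) → ℕ → List ℕ → List ℕ
pushes g zero    l = l
pushes g (suc n) l = push g (pushes g n l)

head-pushes : ∀ g n b bs → head (pushes g n (b ∷ bs)) ≡ just (iter g n b)
head-pushes g zero    b bs = refl
head-pushes g (suc n) b bs with pushes g n (b ∷ bs) | head-pushes g n b bs
... | _ ∷ _ | refl = refl

Lset-cong : ∀ {r r′ : Stacks} k → (∀ x → x < k → r x ≡ r′ x) → Lset r k ≡ Lset r′ k
Lset-cong zero    _  = refl
Lset-cong (suc k) r≡ = cong₂ (λ L st → L ++ topL st)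
  (Lset-cong k (λ x x<k → r≡ x (m<n⇒m<1+n x<k))) (r≡ k (n<1+n k))

Lset-mono : ∀ (r : Stacks) {k k′} → k ≤ k′ → ∀ {x} → x ∈ Lset r k → x ∈ Lset r k′
Lset-mono r {zero} {zero} z≤n ()
Lset-mono r {k} {suc k′} k≤1+k′ x∈ with m≤n⇒m<n∨m≡n k≤1+k′
... | inj₁ k<1+k′ = ∈-++⁺ˡ (Lset-mono r (s≤s⁻¹ k<1+k′) x∈)
... | inj₂ refl   = x∈

acyclic⇒orbit⊈list : ∀ g → (∀ x i j → iter g i x ≡ iter g j x → i ≡ j) →
                     ∀ b (ls : List ℕ) → ¬ (∀ n → iter g n b ∈ ls)
acyclic⇒orbit⊈list g acyclic b ls orbit⊆ls with pigeonhole (n<1+n (length ls)) slot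
  where
  slot : Fin (suc (length ls)) → Fin (length ls)
  slot i = Any.index (orbit⊆ls (toℕ i))
... | i , j , i<j , same-slot = <⇒≢ i<j (acyclic b (toℕ i) (toℕ j) (begin
  iter g (toℕ i) b                           ≡⟨ lookup-index (orbit⊆ls (toℕ i)) ⟩
  lookup ls (Any.index (orbit⊆ls (toℕ i)))  ≡⟨ cong (lookup ls) same-slot ⟩
  lookup ls (Any.index (orbit⊆ls (toℕ j)))  ≡⟨ lookup-index (orbit⊆ls (toℕ j)) ⟨
  iter g (toℕ j) b                           ∎))
  where open ≡-Reasoning

data StackStep (g : ℕ → ℕ) (l l′ : List ℕ) : Set where
  kept    : l′ ≡ l → StackStep g l l′
  cleared : l′ ≡ [] → StackStep g l l′
  pushed  : l′ ≡ push g l → StackStep g l l′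

module StackSequence (lem : ExcludedMiddle 0ℓ) (g : ℕ → ℕ) (σ : ℕ → List ℕ) (T : ℕ)
                     (σ-step : ∀ s → T ≤ s → StackStep g (σ s) (σ (suc s))) where

  ConstantFrom : ℕ → Set
  ConstantFrom T′ = ∀ s → T′ ≤ s → σ s ≡ σ T′

  []-absorbing : ∀ {s s′} → T ≤ s → σ s ≡ [] → s ≤′ s′ → σ s′ ≡ []
  []-absorbing _   σs≡[] ≤′-refl = σs≡[]
  []-absorbing T≤s σs≡[] (≤′-step {s′} s≤′s′) with σ-step s′ (≤-trans T≤s (≤′⇒≤ s≤′s′))
  ... | kept e    = trans e ([]-absorbing T≤s σs≡[] s≤′s′)
  ... | cleared e = e
  ... | pushed e  = trans e (cong (push g) ([]-absorbing T≤s σs≡[] s≤′s′))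

  []⇒constant : ∀ {s} → T ≤ s → σ s ≡ [] → ConstantFrom s
  []⇒constant T≤s σs≡[] s′ s≤s′ = trans ([]-absorbing T≤s σs≡[] (≤⇒≤′ s≤s′)) (sym σs≡[])

  first-change : ∀ {s s′} → T ≤ s → s ≤′ s′ →
                 σ s′ ≡ σ s ⊎ ∃ λ t → T ≤ t × (σ t ≡ [] ⊎ σ t ≡ push g (σ s))
  first-change _   ≤′-refl = inj₁ refl
  first-change T≤s s≤′1+s′@(≤′-step {s′} s≤′s′)
    with first-change T≤s s≤′s′ | σ-step s′ (≤-trans T≤s (≤′⇒≤ s≤′s′))
  ... | inj₂ moved | _         = inj₂ moved
  ... | inj₁ same  | kept e    = inj₁ (trans e same)
  ... | inj₁ same  | cleared e = inj₂ (suc s′ , ≤-trans T≤s (≤′⇒≤ s≤′1+s′) , inj₁ e)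
  ... | inj₁ same  | pushed e  =
    inj₂ (suc s′ , ≤-trans T≤s (≤′⇒≤ s≤′1+s′) , inj₂ (trans e (cong (push g) same)))

  module _ (unstable : ¬ ∃ λ T′ → T ≤ T′ × ConstantFrom T′) where

    changes-after : ∀ T′ → T ≤ T′ → ∃ λ s → T′ ≤ s × σ s ≢ σ T′
    changes-after T′ T≤T′ with lem {∃ λ s → T′ ≤ s × σ s ≢ σ T′}
    ... | yes changes = changes
    ... | no ¬changes = ⊥-elim (unstable (T′ , T≤T′ , λ s T′≤s →
      decidable-stable (≡-dec _≟_ (σ s) (σ T′)) (λ σs≢ → ¬changes (s , T′≤s , σs≢))))

    pushes-reached : ∀ n → ∃ λ s → T ≤ s × σ s ≡ pushes g n (σ T)
    pushes-reached zero = T , ≤-refl , refl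
    pushes-reached (suc n) with pushes-reached n
    ... | s , T≤s , σs≡ with changes-after s T≤s
    ... | s′ , s≤s′ , σs′≢σs with first-change T≤s (≤⇒≤′ s≤s′)
    ... | inj₁ σs′≡σs                    = contradiction σs′≡σs σs′≢σs
    ... | inj₂ (t , T≤t , inj₁ σt≡[])    = ⊥-elim (unstable (t , T≤t , []⇒constant T≤t σt≡[]))
    ... | inj₂ (t , T≤t , inj₂ σt≡push) = t , T≤t , trans σt≡push (cong (push g) σs≡)

  stabilises : (∀ x i j → iter g i x ≡ iter g j x → i ≡ j) →
               (ls : List ℕ) → (∀ s y → head (σ s) ≡ just y → y ∈ ls) →
               ∃ λ T′ → T ≤ T′ × ConstantFrom T′
  stabilises acyclic ls tops∈ls with lem {∃ λ T′ → T ≤ T′ × ConstantFrom T′}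
  ... | yes stable = stable
  ... | no unstable with σ T in σT≡
  ...   | [] = T , ≤-refl , []⇒constant ≤-refl σT≡
  ...   | b ∷ bs = ⊥-elim (acyclic⇒orbit⊈list g acyclic b ls orbit∈ls)
    where
    orbit∈ls : ∀ n → iter g n b ∈ ls
    orbit∈ls n with pushes-reached unstable n
    ... | s , _ , σs≡ = tops∈ls s (iter g n b)
      (trans (cong head (trans σs≡ (cong (pushes g n) σT≡))) (head-pushes g n b bs))

-- Consequence operators

module _ (α : Approx) where

  HsOp-mono : ∀ {s} {X Y : Pred ℕ 0ℓ} → X ⊆ Y → HsOp α s X ⊆ HsOp α s Y
  HsOp-mono X⊆Y = Any.map λ (p₁≡y , D⊆X) → p₁≡y , All.map X⊆Y D⊆X

  HOp-mono : ∀ {X Y : Pred ℕ 0ℓ} → X ⊆ Y → HOp α X ⊆ HOp α Y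
  HOp-mono X⊆Y (s , y∈) = s , HsOp-mono X⊆Y y∈

  HsOp[]⇒HOp∅ : ∀ {s y} → HsOp α s (_∈ []) y → HOp α ∅ y
  HsOp[]⇒HOp∅ y∈ = _ , HsOp-mono (λ ()) y∈

  HsOp-stage-mono : IsIncreasing α → ∀ {s s′ X} → s ≤′ s′ → HsOp α s X ⊆ HsOp α s′ X
  HsOp-stage-mono inc ≤′-refl               y∈ = y∈
  HsOp-stage-mono inc (≤′-step {s′} s≤′s′) y∈ = Any-resp-⊆ (inc s′) (HsOp-stage-mono inc s≤′s′ y∈)

module ClosureLogic (α : Approx) (q : QDS)
         (extensive : ∀ (X : Pred ℕ 0ℓ) → X ⊆ HOp α X)
         (idempotent : ∀ (X : Pred ℕ 0ℓ) → HOp α (HOp α X) ⊆ HOp α X)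
         (conn : Connectives α q) where
  open QDS q
  open Connectives conn

  HOp-⊆-closure : ∀ {X Y : Pred ℕ 0ℓ} → X ⊆ HOp α Y → HOp α X ⊆ HOp α Y
  HOp-⊆-closure {Y = Y} X⊆HY = idempotent Y ∘ HOp-mono α X⊆HY

  HOp-explosion : ∀ {X y} → HOp α X y → HOp α X (neg y) → HOp α X c
  HOp-explosion {y = y} ⊢y ⊢¬y = HOp-⊆-closure [ (λ { refl → ⊢y }) , (λ { refl → ⊢¬y }) ]′ (ax1 y)

  HOp-¬¬-elim : ∀ {X y} → HOp α X (neg (neg y)) → HOp α X y
  HOp-¬¬-elim {y = y} ⊢¬¬y =
    HOp-⊆-closure (λ { refl → ⊢¬¬y }) (proj₂ (ax2 y) (extensive ｛ y ｝ refl))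

  HOp-by-cases : ∀ {X y z} → HOp α (X ∪ ｛ y ｝) z → HOp α (X ∪ ｛ neg y ｝) z → HOp α X z
  HOp-by-cases {X} {y} y⊢z ¬y⊢z = HOp-⊆-closure premises (proj₂ (ax4 X y (neg y)) (y⊢z , ¬y⊢z))
    where
    premises : X ∪ ｛ or y (neg y) ｝ ⊆ HOp α X
    premises (inj₁ x∈X) = extensive X x∈X
    premises (inj₂ refl) = HOp-mono α (λ ()) (ax3 y)

-- One step of the procedure

module _ (α : Approx) (q : QDS) where
  open QDS q
  open Procedure α q

  χᵣ : ℕ → Stacks → ℕ → Pred ℕ 0ℓ
  χᵣ s r k = HsOp α s (_∈ Lset r (suc k))

  Tension : ℕ → Stacks → ℕ → Set
  Tension s r k = χᵣ s r k c ⊎ χᵣ s r k c⁻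

  NoTensionBelow : ℕ → Stacks → ℕ → Set
  NoTensionBelow s r z = ∀ k → k < z → ¬ Tension s r k

  χ?-reflects : ∀ s r k y → Reflects (χᵣ s r k y) (χ? s r k y)
  χ?-reflects s r k y = Dec.proof (HsMem? α s (Lset r (suc k)) y)

  Lset-skip-empty : ∀ {r : Stacks} {k} → r k ≡ [] → Lset r (suc k) ≡ Lset r k
  Lset-skip-empty {r} {k} rk≡[] =
    trans (cong (λ st → Lset r k ++ topL st) rk≡[]) (++-identityʳ (Lset r k))

  χᵣ-skip-empty : ∀ {s r k} → r k ≡ [] → χᵣ s r k ⊆ HsOp α s (_∈ Lset r k)
  χᵣ-skip-empty {s} {r} {k} rk≡[] = subst (λ L → HsOp α s (_∈ L) _) (Lset-skip-empty {r} {k} rk≡[])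

  -- The searches made by `step`; stepShape abstracts over them, so they must
  -- coincide syntactically with those in the definition of `step`.
  tension? : ℕ → Stacks → ℕ → Bool
  tension? s r k = χ? s r k c ∨ χ? s r k c⁻

  retract? : ℕ → Stacks → ℕ → Bool
  retract? s r k = χ? s r k c ∧ allLt (λ k′ → not (χ? s r k′ c⁻)) k

  revise? : ℕ → Stacks → ℕ → Bool
  revise? s r k = χ? s r k c⁻ ∧ allLt (λ k′ → not (χ? s r k′ c)) (suc k)

  tension?-reflects : ∀ s r k → Reflects (Tension s r k) (tension? s r k)
  tension?-reflects s r k = χ?-reflects s r k c ⊎-reflects χ?-reflects s r k c⁻

  retract?-reflects : ∀ s r k →
    Reflects (χᵣ s r k c × (∀ k′ → k′ < k → ¬ χᵣ s r k′ c⁻)) (retract? s r k)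
  retract?-reflects s r k =
    χ?-reflects s r k c ×-reflects allLt-reflects (λ k′ → ¬-reflects (χ?-reflects s r k′ c⁻)) k

  revise?-reflects : ∀ s r k →
    Reflects (χᵣ s r k c⁻ × (∀ k′ → k′ < suc k → ¬ χᵣ s r k′ c)) (revise? s r k)
  revise?-reflects s r k =
    χ?-reflects s r k c⁻ ×-reflects
      allLt-reflects (λ k′ → ¬-reflects (χ?-reflects s r k′ c)) (suc k)

  module _ (consistent : Consistent α q) where

    firstTension-nonempty : ∀ {s r z} → Tension s r z → NoTensionBelow s r z → r z ≢ []
    firstTension-nonempty {s} {r} {zero} tension _ r0≡[] =
      [ proj₁ consistent ∘ base , proj₂ consistent ∘ base ]′ tension
      where
      base : ∀ {y} → χᵣ s r 0 y → HOp α ∅ y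
      base = HsOp[]⇒HOp∅ α ∘ χᵣ-skip-empty {s} {r} {0} r0≡[]
    firstTension-nonempty {s} {r} {suc z} tension calm r1+z≡[] =
      calm z (n<1+n z) (Sum.map skip skip tension)
      where
      skip : ∀ {y} → χᵣ s r (suc z) y → χᵣ s r z y
      skip = χᵣ-skip-empty {s} {r} {suc z} r1+z≡[]

    data StepShape (s m : ℕ) (r : Stacks) (st : State) : Set where
      extend  : State.m st ≡ suc m → (∀ x → x ≤ m → State.r st x ≡ r x) →
                State.r st (suc m) ≡ f (suc m) ∷ [] → (∀ k → k ≤ m → ¬ Tension s r k) →
                StepShape s m r st
      retract : ∀ z → z ≤ m → χᵣ s r z c → NoTensionBelow s r z → r z ≢ [] →
                State.m st ≡ suc z → (∀ x → x < z → State.r st x ≡ r x) →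
                State.r st z ≡ [] → State.r st (suc z) ≡ f (suc z) ∷ [] →
                StepShape s m r st
      revise  : ∀ z → z ≤ m → χᵣ s r z c⁻ → NoTensionBelow s r z → r z ≢ [] →
                State.m st ≡ z → (∀ x → x < z → State.r st x ≡ r x) →
                State.r st z ≡ push f⁻ (r z) →
                StepShape s m r st

    retract-first : ∀ {s m r z} → least (retract? s r) m ≡ just z →
                    z ≤ m × χᵣ s r z c × NoTensionBelow s r z
    retract-first {s} {m} {r} found with least≡just⇒ (retract?-reflects s r) m found
    ... | z≤m , (c∈χz , c⁻∉χ<z) , earlier-fail = z≤m , c∈χz , calm
      where
      calm : NoTensionBelow s r _
      calm k k<z tension = earlier-fail k k<z
        ( [ id , (λ c⁻∈χk → contradiction c⁻∈χk (c⁻∉χ<z k k<z)) ]′ tension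
        , λ k′ k′<k → c⁻∉χ<z k′ (<-trans k′<k k<z))

    revise-first : ∀ {s m r z} → least (revise? s r) m ≡ just z →
                   z ≤ m × χᵣ s r z c⁻ × NoTensionBelow s r z
    revise-first {s} {m} {r} found with least≡just⇒ (revise?-reflects s r) m found
    ... | z≤m , (c⁻∈χz , c∉χ≤z) , earlier-fail = z≤m , c⁻∈χz , calm
      where
      calm : NoTensionBelow s r _
      calm k k<z tension = earlier-fail k k<z
        ( [ (λ c∈χk → contradiction c∈χk (c∉χ≤z k (m<n⇒m<1+n k<z))) , id ]′ tension
        , λ k′ k′<1+k → c∉χ≤z k′ (<-trans k′<1+k (s≤s k<z)))

    -- At the least tension level k₀, retract? holds if c ∈ χ(k₀) and revise? otherwise.
    searches-exhaustive : ∀ {s m r k₀} → least (tension? s r) m ≡ just k₀ →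
      least (retract? s r) m ≡ nothing → least (revise? s r) m ≡ nothing → ⊥
    searches-exhaustive {s} {m} {r} {k₀} found no-retract no-revise
      with least≡just⇒ (tension?-reflects s r) m found | HsMem? α s (Lset r (suc k₀)) c
    ... | k₀≤m , _ , calm | yes c∈χk₀ =
      least≡nothing⇒ (retract?-reflects s r) m no-retract k₀ k₀≤m
        (c∈χk₀ , λ k k<k₀ → calm k k<k₀ ∘ inj₂)
    ... | k₀≤m , tension , calm | no c∉χk₀ =
      least≡nothing⇒ (revise?-reflects s r) m no-revise k₀ k₀≤m
        ([ (λ c∈χk₀ → contradiction c∈χk₀ c∉χk₀) , id ]′ tension , c∉χ≤k₀)
      where
      c∉χ≤k₀ : ∀ k → k < suc k₀ → ¬ χᵣ s r k c
      c∉χ≤k₀ k k<1+k₀ with m<1+n⇒m<n∨m≡n k<1+k₀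
      ... | inj₁ k<k₀ = calm k k<k₀ ∘ inj₁
      ... | inj₂ refl = c∉χk₀

    stepShape : ∀ s m r → StepShape s m r (step s ⟨ m , r ⟩)
    stepShape s m r with least (tension? s r) m in found
    ... | nothing = extend refl
      (λ x x≤m → if-yes (<ᵇ-reflects-< x (suc m)) (s≤s x≤m))
      (trans (if-no (<ᵇ-reflects-< (suc m) (suc m)) (n≮n (suc m)))
             (if-yes (≡ᵇ-reflects-≡ (suc m) (suc m)) refl))
      (least≡nothing⇒ (tension?-reflects s r) m found)
    ... | just k₀ with least (retract? s r) m in retract-found
                     | least (revise? s r) m in revise-found
    ... | just z | _ with HsMem? α s [] c | retract-first retract-found
    ...   | yes c∈H∅ | _ = ⊥-elim (proj₁ consistent (HsOp[]⇒HOp∅ α c∈H∅))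
    ...   | no _ | z≤m , c∈χz , calm = retract z z≤m c∈χz calm
      (firstTension-nonempty (inj₁ c∈χz) calm) refl
      (λ x x<z → if-yes (<ᵇ-reflects-< x z) x<z)
      (trans (if-no (<ᵇ-reflects-< z z) (n≮n z)) (if-no (≡ᵇ-reflects-≡ z (suc z)) (1+n≢n ∘ sym)))
      (trans (if-no (<ᵇ-reflects-< (suc z) z) (≤⇒≯ (n≤1+n z)))
             (if-yes (≡ᵇ-reflects-≡ (suc z) (suc z)) refl))
    stepShape s m r | just k₀ | nothing | just z with revise-first revise-found
    ... | z≤m , c⁻∈χz , calm = revise z z≤m c⁻∈χz calm
      (firstTension-nonempty (inj₂ c⁻∈χz) calm) refl
      (λ x x<z → if-yes (<ᵇ-reflects-< x z) x<z)
      (trans (if-no (<ᵇ-reflects-< z z) (n≮n z)) (if-yes (≡ᵇ-reflects-≡ z z) refl))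
    stepShape s m r | just k₀ | nothing | nothing =
      ⊥-elim (searches-exhaustive {s} {m} {r} found retract-found revise-found)

    shape : ∀ s → StepShape s (mstage s) (rstage s) (state (suc s))
    shape s = stepShape s (mstage s) (rstage s)

    kept-below : ∀ s x → suc x < mstage (suc s) → rstage (suc s) x ≡ rstage s x
    kept-below s x 1+x<m′ with shape s
    ... | extend m′≡ same _ _             = same x (<⇒≤ (s≤s⁻¹ (subst (suc x <_) m′≡ 1+x<m′)))
    ... | retract _ _ _ _ _ m′≡ same _ _ = same x (s≤s⁻¹ (subst (suc x <_) m′≡ 1+x<m′))
    ... | revise _ _ _ _ _ m′≡ same _    = same x (<-trans (n<1+n x) (subst (suc x <_) m′≡ 1+x<m′))

    Refutes : Pred ℕ 0ℓ → ℕ → Set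
    Refutes Γ y = HOp α (Γ ∪ ｛ y ｝) c ⊎ HOp α (Γ ∪ ｛ y ｝) c⁻

    Justified : Stacks → ℕ → Set
    Justified r x = r x ≡ f x ∷ [] ⊎ Refutes (_∈ Lset r x) (f x)

    refuted-kept : ∀ {r r′ : Stacks} {z} → (∀ y → y < z → r′ y ≡ r y) →
                   Refutes (_∈ Lset r z) (f z) → Justified r′ z
    refuted-kept {z = z} same = inj₂ ∘ subst (λ L → Refutes (_∈ L) (f z)) (sym (Lset-cong z same))

    Justified-cong : ∀ {r r′ : Stacks} {x} → (∀ y → y ≤ x → r′ y ≡ r y) →
                     Justified r x → Justified r′ x
    Justified-cong {x = x} agree (inj₁ fresh)   = inj₁ (trans (agree x ≤-refl) fresh)
    Justified-cong         agree (inj₂ refuted) = refuted-kept (λ y y<x → agree y (<⇒≤ y<x)) refuted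

    tension⇒refuted : ∀ {s r z} → Justified r z → Tension s r z → Refutes (_∈ Lset r z) (f z)
    tension⇒refuted {s} {r} {z} (inj₁ fresh) = Sum.map from-fresh from-fresh
      where
      from-fresh : ∀ {y} → χᵣ s r z y → HOp α ((_∈ Lset r z) ∪ ｛ f z ｝) y
      from-fresh y∈ = s , HsOp-mono α (λ x∈ → Sum.map id (λ { (here x≡fz) → sym x≡fz })
        (∈-++⁻ (Lset r z) (subst (λ st → _ ∈ Lset r z ++ topL st) fresh x∈))) y∈
    tension⇒refuted (inj₂ refuted) _ = refuted

    justified : ∀ s x → x ≤ mstage s → Justified (rstage s) x
    justified zero    zero _ = inj₁ refl
    justified (suc s) x x≤m′ with shape s
    ... | extend m′≡ same fresh _ with m≤n⇒m<n∨m≡n (subst (x ≤_) m′≡ x≤m′)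
    ...   | inj₁ x<1+m = Justified-cong (λ y y≤x → same y (≤-trans y≤x (s≤s⁻¹ x<1+m)))
                                        (justified s x (s≤s⁻¹ x<1+m))
    ...   | inj₂ refl  = inj₁ fresh
    justified (suc s) x x≤m′ | retract z z≤m c∈χz _ _ m′≡ same _ fresh
      with m≤n⇒m<n∨m≡n (subst (x ≤_) m′≡ x≤m′)
    ...   | inj₂ refl  = inj₁ fresh
    ...   | inj₁ x<1+z with m<1+n⇒m<n∨m≡n x<1+z
    ...     | inj₁ x<z = Justified-cong (λ y y≤x → same y (≤-<-trans y≤x x<z))
                                        (justified s x (≤-trans (<⇒≤ x<z) z≤m))
    ...     | inj₂ refl = refuted-kept same (tension⇒refuted (justified s z z≤m) (inj₁ c∈χz))
    justified (suc s) x x≤m′ | revise z z≤m c⁻∈χz _ _ m′≡ same _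
      with m≤n⇒m<n∨m≡n (subst (x ≤_) m′≡ x≤m′)
    ...   | inj₁ x<z  = Justified-cong (λ y y≤x → same y (≤-<-trans y≤x x<z))
                                       (justified s x (≤-trans (<⇒≤ x<z) z≤m))
    ...   | inj₂ refl = refuted-kept same (tension⇒refuted (justified s z z≤m) (inj₂ c⁻∈χz))

    -- Every level settles

    SettledBelow : ℕ → ℕ → Set
    SettledBelow u T = ∀ s → T ≤ s → u ≤ mstage s × (∀ x → x < u → rstage s x ≡ rstage T x)

    Settled : ℕ → ℕ → Set
    Settled u T = ∀ s → T ≤ s → u < mstage s × (∀ x → x ≤ u → rstage s x ≡ rstage T x)

    Settled⇒SettledBelow : ∀ {u T} → Settled u T → SettledBelow (suc u) T
    Settled⇒SettledBelow settled s T≤s =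
      proj₁ (settled s T≤s) , λ x x<1+u → proj₂ (settled s T≤s) x (s≤s⁻¹ x<1+u)

    SettledBelow⇒steady : ∀ {u T s x} → SettledBelow u T → T ≤ s → x < u →
                          rstage (suc s) x ≡ rstage s x
    SettledBelow⇒steady {s = s} {x} below T≤s x<u =
      trans (proj₂ (below (suc s) (m≤n⇒m≤1+n T≤s)) x x<u) (sym (proj₂ (below s T≤s) x x<u))

    data LevelStep (u s : ℕ) : Set where
      steady  : rstage (suc s) u ≡ rstage s u → u < mstage (suc s) → LevelStep u s
      emptied : rstage s u ≢ [] → rstage (suc s) u ≡ [] → LevelStep u s
      grown   : rstage s u ≢ [] → rstage (suc s) u ≡ push f⁻ (rstage s u) → LevelStep u s

    levelStep : ∀ {u T} → SettledBelow u T → ∀ s → T ≤ s → LevelStep u s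
    levelStep {u} below s T≤s with shape s | below s T≤s
    ... | extend m′≡ same _ _ | u≤m , _ = steady (same u u≤m) (subst (u <_) (sym m′≡) (s≤s u≤m))
    ... | retract z _ _ _ rz≢[] m′≡ same rz′≡[] _ | _ with <-cmp u z
    ...   | tri< u<z _ _ = steady (same u u<z) (subst (u <_) (sym m′≡) (m<n⇒m<1+n u<z))
    ...   | tri≈ _ refl _ = emptied rz≢[] rz′≡[]
    ...   | tri> _ _ z<u =
      contradiction (trans (sym (SettledBelow⇒steady below T≤s z<u)) rz′≡[]) rz≢[]
    levelStep {u} below s T≤s | revise z _ _ _ rz≢[] m′≡ same rz′≡push | _ with <-cmp u z
    ...   | tri< u<z _ _ = steady (same u u<z) (subst (u <_) (sym m′≡) u<z)
    ...   | tri≈ _ refl _ = grown rz≢[] rz′≡push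
    ...   | tri> _ _ z<u =
      contradiction (trans (sym rz′≡push) (SettledBelow⇒steady below T≤s z<u)) (push-≢ f⁻ rz≢[])

    module _ (lem : ExcludedMiddle 0ℓ) (f⁻-acyclic : ∀ x i j → iter f⁻ i x ≡ iter f⁻ j x → i ≡ j)
             (loopless : Loopless) where

      SettledBelow⇒Settled : ∀ {u T} → SettledBelow u T → ∃ (Settled u)
      SettledBelow⇒Settled {u} {T} below
        with StackSequence.stabilises lem f⁻ (λ s → rstage s u) T stackStep
               f⁻-acyclic (proj₁ (loopless u)) (proj₂ (loopless u))
        where
        stackStep : ∀ s → T ≤ s → StackStep f⁻ (rstage s u) (rstage (suc s) u)
        stackStep s T≤s with levelStep below s T≤s
        ... | steady e _  = kept e
        ... | emptied _ e = cleared e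
        ... | grown _ e   = pushed e
      ... | T′ , T≤T′ , constant = suc T′ , settled
        where
        settled : Settled u (suc T′)
        settled (suc s) 1+T′≤1+s = active , agree
          where
          T′≤s : T′ ≤ s
          T′≤s = s≤s⁻¹ 1+T′≤1+s
          unchanged : rstage (suc s) u ≡ rstage s u
          unchanged = trans (constant (suc s) (m≤n⇒m≤1+n T′≤s)) (sym (constant s T′≤s))
          active : u < mstage (suc s)
          active with levelStep below s (≤-trans T≤T′ T′≤s)
          ... | steady _ u<m′ = u<m′
          ... | emptied ne e  = contradiction (trans (sym unchanged) e) ne
          ... | grown ne e    = contradiction (trans (sym e) unchanged) (push-≢ f⁻ ne)
          agree : ∀ x → x ≤ u → rstage (suc s) x ≡ rstage (suc T′) x
          agree x x≤u with m≤n⇒m<n∨m≡n x≤u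
          ... | inj₁ x<u = trans (proj₂ (below (suc s) (≤-trans T≤T′ (m≤n⇒m≤1+n T′≤s))) x x<u)
                                 (sym (proj₂ (below (suc T′) (m≤n⇒m≤1+n T≤T′)) x x<u))
          ... | inj₂ refl = trans (constant (suc s) (m≤n⇒m≤1+n T′≤s))
                                  (sym (constant (suc T′) (n≤1+n T′)))

      settles : ∀ u → ∃ (Settled u)
      settles zero    = SettledBelow⇒Settled {0} {0} (λ _ _ → z≤n , λ _ ())
      settles (suc u) = SettledBelow⇒Settled (Settled⇒SettledBelow (proj₂ (settles u)))

      -- The limit

      stage : ℕ → ℕ
      stage u = proj₁ (settles u)

      R : Stacks
      R x = rstage (stage x) x

      level-active : ∀ u s → stage u ≤ s → u < mstage s
      level-active u s le = proj₁ (proj₂ (settles u) s le)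

      stack-settled : ∀ u s x → stage u ≤ s → x ≤ u → rstage s x ≡ rstage (stage u) x
      stack-settled u s x le = proj₂ (proj₂ (settles u) s le) x

      stack-limit : ∀ u s x → stage u ≤ s → x ≤ u → rstage s x ≡ R x
      stack-limit u s x le x≤u = begin
        rstage s x                   ≡⟨ stack-settled u s x le x≤u ⟩
        rstage (stage u) x           ≡⟨ stack-settled u (stage u ⊔ stage x) x (m≤m⊔n _ _) x≤u ⟨
        rstage (stage u ⊔ stage x) x ≡⟨ stack-settled x (stage u ⊔ stage x) x (m≤n⊔m _ _) ≤-refl ⟩
        R x                          ∎
        where open ≡-Reasoning

      Lset-limit : ∀ u s k → stage u ≤ s → k ≤ suc u → Lset (rstage s) k ≡ Lset R k
      Lset-limit u s k le k≤1+u =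
        Lset-cong k (λ x x<k → stack-limit u s x le (s≤s⁻¹ (≤-trans x<k k≤1+u)))

      Γ : ℕ → Pred ℕ 0ℓ
      Γ k = _∈ Lset R k

      Derivable : Pred ℕ 0ℓ
      Derivable y = ∃ λ k → HOp α (Γ k) y

      Γ-mono : ∀ {k k′} → k ≤ k′ → Γ k ⊆ Γ k′
      Γ-mono k≤k′ = Lset-mono R k≤k′

      settled-no-tension : ∀ k s → stage k ≤ s → ¬ Tension s (rstage s) k
      settled-no-tension k s le tension with shape s
      ... | extend _ _ _ calm = calm k (<⇒≤ (level-active k s le)) tension
      ... | retract z _ _ calm rz≢[] _ _ rz′≡[] _ = rz≢[] (begin
        rstage s z       ≡⟨ stack-limit k s z le z≤k ⟩
        R z              ≡⟨ stack-limit k (suc s) z (m≤n⇒m≤1+n le) z≤k ⟨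
        rstage (suc s) z ≡⟨ rz′≡[] ⟩
        []               ∎)
        where
        open ≡-Reasoning
        z≤k : z ≤ k
        z≤k = ≮⇒≥ (λ k<z → calm k k<z tension)
      ... | revise z _ _ calm _ m′≡ _ _ =
        <⇒≱ (subst (k <_) m′≡ (level-active k (suc s) (m≤n⇒m≤1+n le)))
            (≮⇒≥ (λ k<z → calm k k<z tension))

      module _ (inc : IsIncreasing α) where

        χ-from-limit : ∀ {k y s₀ s} → s₀ ≤ s → stage k ≤ s → HsOp α s₀ (Γ k) y → χ s k y
        χ-from-limit {k} {y} {s = s} s₀≤s le y∈ =
          subst (λ L → HsOp α s (_∈ L) y) (sym (Lset-limit k s (suc k) le ≤-refl))
            (HsOp-mono α (Lset-mono R (n≤1+n k)) (HsOp-stage-mono α inc (≤⇒≤′ s₀≤s) y∈))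

        Derivable⇒χ : ∀ {y} → Derivable y → ∃ λ k → ∃ λ s → stage k ≤ s × χ s k y
        Derivable⇒χ (k , s₀ , y∈) =
          k , s₀ ⊔ stage k , m≤n⊔m _ _ , χ-from-limit (m≤m⊔n _ _) (m≤n⊔m _ _) y∈

        ¬Derivable-c : ¬ Derivable c
        ¬Derivable-c ⊢c with Derivable⇒χ ⊢c
        ... | k , s , le , c∈χ = settled-no-tension k s le (inj₁ c∈χ)

        ¬Derivable-c⁻ : ¬ Derivable c⁻
        ¬Derivable-c⁻ ⊢c⁻ with Derivable⇒χ ⊢c⁻
        ... | k , s , le , c⁻∈χ = settled-no-tension k s le (inj₂ c⁻∈χ)

        χ-step-kept : ∀ s i → suc i < mstage (suc s) → χ s i ⊆ χ (suc s) i
        χ-step-kept s i 1+i<m′ y∈ =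
          subst (λ L → HsOp α (suc s) (_∈ L) _)
            (Lset-cong (suc i) (λ x x<1+i → sym (kept-below s x (≤-<-trans x<1+i 1+i<m′))))
            (HsOp-stage-mono α inc (≤′-step ≤′-refl) y∈)

        Aq⇒Derivable : Aq ⊆ Derivable
        Aq⇒Derivable (x , refl , t , eventually-in) with eventually-in t ≤-refl
        ... | i₀ , i₀<m , fx∈χ with persists (≤⇒≤′ (m≤n⊔m (stage i₀) t))
          where
          -- Either the levels up to i are kept, or the new witness lies below i.
          persists : ∀ {s} → t ≤′ s → ∃ λ i → i ≤ i₀ × i < mstage s × χ s i (f x)
          persists ≤′-refl = i₀ , ≤-refl , i₀<m , fx∈χ
          persists (≤′-step {s} t≤′s) with persists t≤′s
          ... | i , i≤i₀ , i<m , fx∈χi with suc i <? mstage (suc s)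
          ...   | yes 1+i<m′ = i , i≤i₀ , <-trans (n<1+n i) 1+i<m′ , χ-step-kept s i 1+i<m′ fx∈χi
          ...   | no 1+i≮m′ with eventually-in (suc s) (≤′⇒≤ (≤′-step t≤′s))
          ...     | j , j<m′ , fx∈χj =
            j , ≤-trans (s≤s⁻¹ (≤-trans j<m′ (≮⇒≥ 1+i≮m′))) i≤i₀ , j<m′ , fx∈χj
        ... | i , i≤i₀ , _ , fx∈χi = suc i , stage i₀ ⊔ t ,
          subst (λ L → HsOp α (stage i₀ ⊔ t) (_∈ L) (f x))
            (Lset-limit i₀ (stage i₀ ⊔ t) (suc i) (m≤m⊔n _ _) (s≤s i≤i₀)) fx∈χi

        module _ (f-surjective : ∀ y → ∃ λ x → f x ≡ y) where

          Derivable⇒Aq : Derivable ⊆ Aq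
          Derivable⇒Aq {y} (k , s₀ , y∈) with f-surjective y
          ... | x , refl = x , refl , s₀ ⊔ stage k , λ s le →
            k , level-active k s (≤-trans (m≤n⊔m _ _) le) ,
            χ-from-limit (≤-trans (m≤m⊔n _ _) le) (≤-trans (m≤n⊔m _ _) le) y∈

          module _ (extensive : ∀ (X : Pred ℕ 0ℓ) → X ⊆ HOp α X)
                   (idempotent : ∀ (X : Pred ℕ 0ℓ) → HOp α (HOp α X) ⊆ HOp α X)
                   (conn : Connectives α q) where
            open Connectives conn using (neg; ax5)
            open ClosureLogic α q extensive idempotent conn

            derivable-or-refuted : ∀ y → Derivable y ⊎ ∃ λ k → Refutes (Γ k) y
            derivable-or-refuted y with f-surjective y
            ... | a , refl
              with Justified-cong (λ x x≤a → sym (stack-limit a (stage a) x ≤-refl x≤a))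
                     (justified (stage a) a (<⇒≤ (level-active a (stage a) ≤-refl)))
            ...   | inj₁ fresh   = inj₁ (suc a , extensive (Γ (suc a))
                      (∈-++⁺ʳ (Lset R a) (subst (λ st → f a ∈ topL st) (sym fresh) (here refl))))
            ...   | inj₂ refuted = inj₂ (a , refuted)

            derivable-or-neg : ∀ y → Derivable y ⊎ Derivable (neg y)
            derivable-or-neg y with derivable-or-refuted y | derivable-or-refuted (neg y)
            ... | inj₁ ⊢y | _ = inj₁ ⊢y
            ... | _ | inj₁ ⊢¬y = inj₂ ⊢¬y
            ... | inj₂ (a , inj₁ y⊢c) | _ = inj₂ (a , ax5 (Γ a) y y⊢c)
            ... | _ | inj₂ (b , inj₁ ¬y⊢c) =
              inj₁ (b , HOp-¬¬-elim (ax5 (Γ b) (neg y) ¬y⊢c))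
            ... | inj₂ (a , inj₂ y⊢c⁻) | inj₂ (b , inj₂ ¬y⊢c⁻) =
              ⊥-elim (¬Derivable-c⁻ (a ⊔ b , HOp-by-cases
                (raise (m≤m⊔n a b) y⊢c⁻) (raise (m≤n⊔m a b) ¬y⊢c⁻)))
              where
              raise : ∀ {k k′ z} → k ≤ k′ → HOp α (Γ k ∪ ｛ z ｝) c⁻ → HOp α (Γ k′ ∪ ｛ z ｝) c⁻
              raise k≤k′ = HOp-mono α (Sum.map (Γ-mono k≤k′) id)

            ¬Derivable-both : ∀ y → Derivable y → Derivable (neg y) → ⊥
            ¬Derivable-both y (k , ⊢y) (k′ , ⊢¬y) = ¬Derivable-c (k ⊔ k′ ,
              HOp-explosion
                (HOp-mono α (Γ-mono (m≤m⊔n k k′)) ⊢y) (HOp-mono α (Γ-mono (m≤n⊔m k k′)) ⊢¬y))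

            Aq-isCompletion : IsCompletion neg Aq
            Aq-isCompletion = completion Aq⇒Derivable Derivable⇒Aq derivable-or-neg ¬Derivable-both

theorem4p3 : ExcludedMiddle 0ℓ →
    (α : Approx) (q : QDS) →
    IsIncreasing α →
    IsQDialectical α q →
    Consistent α q →
    (conn : Connectives α q) →
    Procedure.Loopless α q →
    IsCompletion (Connectives.neg conn) (Procedure.Aq α q)
theorem4p3 lem α q inc isQ cons conn loopless =
  Aq-isCompletion α q cons lem f⁻-acyclic loopless inc
    (surjective⇒strictlySurjective _≡_ refl (proj₂ f-perm)) extensive idempotent conn
  where open IsQDialectical isQ
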